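{- Let $\ell\ge2$ and let $T_\ell=\left\{\begin{bmatrix}1&b\\0&1\end{bmatrix}\mid b\in\mathbb{F}_{2^\ell}\right\}\le U_\ell=\left\{\begin{bmatrix}a&b\\0&a^{ -1}\end{bmatrix}\mid a\in\mathbb{F}_{2^\ell}^*,\,b\in\mathbb{F}_{2^\ell}\right\}\le\mathrm{SL}_2(\mathbb{F}_{2^\ell})$ act in the standard way on the set $X=\mathbb{P}^1\mathbb{F}_{2^\ell}$ of one-dimensional subspaces of $\mathbb{F}_{2^\ell}^2$. Then $H^1(T_\ell,\mathbb{F}_2[X])\cong\mathbb{F}_{2^\ell}$ (as abelian groups) and $H^1(T_\ell,\mathbb{F}_2[X])^{U_\ell/T_\ell}=0$.
   Context: $\mathbb{F}_2[X]=\bigoplus_{x\in X}\mathbb{F}_2\vec e_x$ with $g$ acting linearly by $\vec e_x\mapsto\vec e_{g.x}$. A cocycle is $\omega:G\to M$ with $\omega(gh)=g.\omega(h)+\omega(g)$; a coboundary is $g\mapsto g.v-v$ for some $v\in M$; $H^1(G,M)$ is cocycles modulo coboundaries. Since $T_\ell\trianglelefteq U_\ell$, $U_\ell$ acts on cocycles of $T_\ell$ by $(u.\omega)(t)=u.\omega(u^{ -1}tu)$; this induces an action of $U_\ell/T_\ell$ on $H^1(T_\ell,\mathbb{F}_2[X])$, and $H^1(T_\ell,\mathbb{F}_2[X])^{U_\ell/T_\ell}$ denotes its fixed points. -}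

module Defs where

open import Data.Nat using (ℕ; _^_)
open import Data.Fin using (Fin)
import Data.Fin.Properties as FinP
open import Data.Bool using (Bool; _xor_)
open import Data.Maybe using (Maybe; just; nothing)
open import Data.Product using (Σ; ∃; _×_; _,_)
open import Relation.Binary.PropositionalEquality using (_≡_; _≢_; refl; cong; sym; trans)
open import Relation.Nullary using (Dec; yes; no)
open import Relation.Nullary.Decidable using (map′)
open import Algebra.Structures using (IsCommutativeRing)
open import Function.Bundles using (_↔_; Inverse; _⇔_)

record FiniteField (ℓ : ℕ) : Set₁ where
  infixl 7 _*_
  infixl 6 _+_
  field
    Carrier : Set
    _+_ _*_ : Carrier → Carrier → Carrier
    -_      : Carrier → Carrier
    0# 1#   : Carrier
    _⁻¹     : Carrier → Carrier
    isCommutativeRing : IsCommutativeRing _≡_ _+_ _*_ -_ 0# 1#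
    0≢1     : 0# ≢ 1#
    *-inverse : ∀ x → x ≢ 0# → x * (x ⁻¹) ≡ 1#
    card    : Carrier ↔ Fin (2 ^ ℓ)

  _≟_ : (x y : Carrier) → Dec (x ≡ y)
  x ≟ y = map′ (λ e → trans (sym (Inverse.inverseʳ card refl))
                        (trans (cong (Inverse.from card) e) (Inverse.inverseʳ card refl))) (cong (Inverse.to card))
               (Inverse.to card x FinP.≟ Inverse.to card y)

module _ {ℓ : ℕ} (F : FiniteField ℓ) where
  open FiniteField F

  record Mat : Set where
    constructor mat
    field a b c d : Carrier

  _·_ : Mat → Mat → Mat
  mat a b c d · mat a' b' c' d' =
    mat (a * a' + b * c') (a * b' + b * d') (c * a' + d * c') (c * b' + d * d')

  -- inverse of a determinant-one matrix (adjugate)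
  inv : Mat → Mat
  inv (mat a b c d) = mat d (- b) (- c) a

  InT : Mat → Set
  InT (mat a b c d) = (a ≡ 1#) × (c ≡ 0#) × (d ≡ 1#)

  InU : Mat → Set
  InU (mat a b c d) = (c ≡ 0#) × (a * d ≡ 1#)

  -- X = P¹(F): a one-dimensional subspace of F² is represented by its
  -- normalised spanning vector:  just x ↦ span (x , 1),  nothing ↦ span (1 , 0).
  X : Set
  X = Maybe Carrier

  rep : X → Carrier × Carrier
  rep (just x) = x , 1#
  rep nothing  = 1# , 0#

  line : Carrier × Carrier → X
  line (p , q) with q ≟ 0#
  ... | yes _ = nothing
  ... | no  _ = just (p * q ⁻¹)

  actX : Mat → X → X
  actX (mat a b c d) x with rep x
  ... | (p , q) = line (a * p + b * q , c * p + d * q)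

  -- F₂[X] = ⊕_{x∈X} F₂ e_x ; X is finite so this is X → F₂ (F₂ = Bool, + = xor)
  M : Set
  M = X → Bool

  -- g e_x = e_{g x}, i.e. (g f)(y) = f (g⁻¹ y)
  actM : Mat → M → M
  actM g f y = f (actX (inv g) y)

  -- 1-cochains on T_ℓ (values outside T_ℓ are irrelevant)
  Cochain : Set
  Cochain = Mat → M

  IsCocycle : Cochain → Set
  IsCocycle ω = ∀ g h → InT g → InT h → ∀ y →
    ω (g · h) y ≡ actM g (ω h) y xor ω g y

  IsCoboundary : Cochain → Set
  IsCoboundary ω = ∃ λ (v : M) → ∀ g → InT g → ∀ y → ω g y ≡ actM g v y xor v y

  _⊕_ : Cochain → Cochain → Cochain
  (ω ⊕ ω') g y = ω g y xor ω' g y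

  Cohomologous : Cochain → Cochain → Set
  Cohomologous ω ω' = IsCoboundary (ω ⊕ ω')

  actU : Mat → Cochain → Cochain
  actU u ω t = actM u (ω ((inv u · t) · u))

  -- H¹(T_ℓ, F₂[X]) ≅ (F, +) as abelian groups: a homomorphism φ from
  -- cocycles to F which induces a bijection on cohomology classes.
  H1≅F : Set
  H1≅F = Σ (Cochain → Carrier) λ φ →
      (∀ ω ω' → IsCocycle ω → IsCocycle ω' → φ (ω ⊕ ω') ≡ φ ω + φ ω')
    × (∀ ω ω' → IsCocycle ω → IsCocycle ω' → (Cohomologous ω ω' ⇔ (φ ω ≡ φ ω')))
    × (∀ k → ∃ λ ω → IsCocycle ω × (φ ω ≡ k))

  H1-fixed-zero : Set
  H1-fixed-zero = ∀ ω → IsCocycle ω →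
    (∀ u → InU u → Cohomologous (actU u ω) ω) → IsCoboundary ω

{-# OPTIONS --safe #-}
module Submission where

-- T ≅ (F, +) fixes ∞ and acts simply transitively on the affine line F = X ∖ {∞}, so
-- F₂[X] = F₂ e_∞ ⊕ F₂[T]. The regular summand has no cohomology, hence the class of a
-- cocycle ω is determined by the homomorphism b ↦ ω(shear b)(∞) in Hom(F, F₂).
-- Summing over F shows |F| · x = 0, so 2^ℓ · 1 = 0 and F has characteristic 2; thus
-- (F, +) is an F₂-vector space, and an F₂-basis e₁, …, eₙ of F identifies Hom(F, F₂)
-- with F through h ↦ Σ h(eᵢ) eᵢ.
-- The diagonal element diag(d⁻¹, d) of U conjugates shear b to shear (d² b), so the
-- homomorphism h of an invariant class satisfies h((d² + 1) b) = 0 for all b.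
-- Choosing d ∉ {0, 1}, possible as ℓ ≥ 2, makes d² + 1 = (d + 1)² invertible, so h = 0.

open import Defs
open import Data.Nat as ℕ using (ℕ; _≤_)
open import Data.Nat.Properties as ℕ using ()
open import Data.Fin using (Fin; zero; suc)
open import Data.Fin.Properties using (pigeonhole; ¬∀⟶∃¬; <⇒≢)
open import Data.Bool using (Bool; true; false; _xor_; if_then_else_)
open import Data.Bool.Properties
  using (xor-same; xor-comm; xor-identityʳ; xor-annihilates-not; xor-∧-commutativeRing)
open import Data.List using (List; []; _∷_)
open import Data.Maybe using (just; nothing)
open import Data.Product using (Σ-syntax; ∃; _×_; _,_)
open import Data.Sum using (_⊎_; inj₁; inj₂)
open import Data.Unit using (⊤; tt)
open import Function using (_∘_; _↔_; Inverse; mk↔ₛ′; mk⇔)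
open import Function.Properties.Inverse using (↔-sym; ↔-trans)
open import Relation.Nullary using (¬_; Dec; yes; no; does; contradiction)
open import Relation.Nullary.Decidable using (dec-true; dec-false; _⊎-dec_)
open import Relation.Binary.Definitions using (DecidableEquality)
open import Relation.Binary.PropositionalEquality
open import Algebra.Core using (Op₂)
open import Algebra.Bundles using (CommutativeRing; CommutativeMonoid; CommutativeSemigroup; Group)
open import Algebra.Structures using (IsCommutativeMonoid; IsAbelianGroup)
import Algebra.Properties.CommutativeSemigroup

module FiniteAbelianGroup {A : Set} {_∙_ : Op₂ A} {ε : A} {_⁻¹ : A → A}
  (isAbelianGroup : IsAbelianGroup _≡_ _∙_ ε _⁻¹) where

  open IsAbelianGroup isAbelianGroup using (isGroup; isCommutativeMonoid)

  commutativeMonoid : CommutativeMonoid _ _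
  commutativeMonoid = record { isCommutativeMonoid = isCommutativeMonoid }

  group : Group _ _
  group = record { isGroup = isGroup }

  open CommutativeMonoid commutativeMonoid using (rawMonoid)
  open import Algebra.Definitions.RawMonoid rawMonoid using () renaming (_×_ to _×ₙ_)
  open import Algebra.Properties.CommutativeMonoid.Sum commutativeMonoid
    using (sum; sum-permute; sum-replicate; sum-cong-≗; ∑-distrib-+)
  open import Algebra.Properties.Group group using (identityʳ-unique; //-rightDividesˡ; //-rightDividesʳ)
  open ≡-Reasoning

  ×ₙ-card≡ε : ∀ {n} → A ↔ Fin n → ∀ x → n ×ₙ x ≡ ε
  ×ₙ-card≡ε {n} card x = identityʳ-unique (sum elem) (n ×ₙ x) (begin
    sum elem ∙ (n ×ₙ x)             ≡⟨ cong (sum elem ∙_) (sym (sum-replicate n)) ⟩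
    sum elem ∙ sum {n} (λ _ → x)    ≡⟨ sym (∑-distrib-+ elem (λ _ → x)) ⟩
    sum (λ i → elem i ∙ x)          ≡⟨ sum-cong-≗ (λ i → sym (Inverse.strictlyInverseʳ card (elem i ∙ x))) ⟩
    sum (elem ∘ Inverse.to π)       ≡⟨ sym (sum-permute elem π) ⟩
    sum elem                        ∎)
    where
    elem : Fin n → A
    elem = Inverse.from card

    translation : A ↔ A
    translation = mk↔ₛ′ (_∙ x) (_∙ (x ⁻¹)) (//-rightDividesˡ x) (//-rightDividesʳ x)

    π : Fin n ↔ Fin n
    π = ↔-trans (↔-sym card) (↔-trans translation card)

module Xor = Algebra.Properties.CommutativeSemigroup (CommutativeRing.+-commutativeSemigroup xor-∧-commutativeRing)

xor-cancel-common : ∀ c a b → (c xor a) xor (c xor b) ≡ a xor b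
xor-cancel-common false a b = refl
xor-cancel-common true  a b = xor-annihilates-not a b

module Characteristic2 {A : Set} {_+_ : Op₂ A} {0# : A}
  (isCommutativeMonoid : IsCommutativeMonoid _≡_ _+_ 0#)
  (x+x≡0 : ∀ x → x + x ≡ 0#) where

  open IsCommutativeMonoid isCommutativeMonoid using (assoc; comm; identityˡ; identityʳ; isCommutativeSemigroup)

  commutativeSemigroup : CommutativeSemigroup _ _
  commutativeSemigroup = record { isCommutativeSemigroup = isCommutativeSemigroup }

  open import Algebra.Properties.CommutativeSemigroup commutativeSemigroup public using (interchange)
  open ≡-Reasoning

  x+[x+y]≡y : ∀ x y → x + (x + y) ≡ y
  x+[x+y]≡y x y = begin
    x + (x + y)  ≡⟨ sym (assoc x x y) ⟩
    (x + x) + y  ≡⟨ cong (_+ y) (x+x≡0 x) ⟩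
    0# + y       ≡⟨ identityˡ y ⟩
    y            ∎

  [x+y]+y≡x : ∀ x y → (x + y) + y ≡ x
  [x+y]+y≡x x y = begin
    (x + y) + y  ≡⟨ assoc x y y ⟩
    x + (y + y)  ≡⟨ cong (x +_) (x+x≡0 y) ⟩
    x + 0#       ≡⟨ identityʳ x ⟩
    x            ∎

  [x+z]+[y+z]≡x+y : ∀ x y z → (x + z) + (y + z) ≡ x + y
  [x+z]+[y+z]≡x+y x y z = begin
    (x + z) + (y + z)  ≡⟨ interchange x z y z ⟩
    (x + y) + (z + z)  ≡⟨ cong ((x + y) +_) (x+x≡0 z) ⟩
    (x + y) + 0#       ≡⟨ identityʳ (x + y) ⟩
    x + y              ∎

  x+y≡0⇒x≡y : ∀ {x y} → x + y ≡ 0# → x ≡ y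
  x+y≡0⇒x≡y {x} {y} x+y≡0 = begin
    x            ≡⟨ sym (x+[x+y]≡y y x) ⟩
    y + (y + x)  ≡⟨ cong (y +_) (trans (comm y x) x+y≡0) ⟩
    y + 0#       ≡⟨ identityʳ y ⟩
    y            ∎

module Bool₂ = Characteristic2 (CommutativeRing.+-isCommutativeMonoid xor-∧-commutativeRing) xor-same

module F₂-VectorSpace {V : Set} {_+_ : Op₂ V} {0# : V}
  (isCommutativeMonoid : IsCommutativeMonoid _≡_ _+_ 0#)
  (x+x≡0 : ∀ x → x + x ≡ 0#)
  (_≟_ : DecidableEquality V) where

  open IsCommutativeMonoid isCommutativeMonoid using (assoc; comm; identityˡ; identityʳ)
  open Characteristic2 isCommutativeMonoid x+x≡0
  open ≡-Reasoning

  Span : List V → V → Set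
  Span []      x = x ≡ 0#
  Span (e ∷ B) x = Span B x ⊎ Span B (x + e)

  span? : ∀ B x → Dec (Span B x)
  span? []      x = x ≟ 0#
  span? (e ∷ B) x = span? B x ⊎-dec span? B (x + e)

  Span-0 : ∀ B → Span B 0#
  Span-0 []      = refl
  Span-0 (e ∷ B) = inj₁ (Span-0 B)

  Span-self : ∀ e B → Span (e ∷ B) e
  Span-self e B = inj₂ (subst (Span B) (sym (x+x≡0 e)) (Span-0 B))

  Span-+ : ∀ B {x y} → Span B x → Span B y → Span B (x + y)
  Span-+ []      refl     refl     = identityʳ 0#
  Span-+ (e ∷ B) (inj₁ p) (inj₁ q) = inj₁ (Span-+ B p q)
  Span-+ (e ∷ B) {x} {y} (inj₁ p) (inj₂ q) = inj₂ (subst (Span B) (sym (assoc x y e)) (Span-+ B p q))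
  Span-+ (e ∷ B) {x} {y} (inj₂ p) (inj₁ q) = inj₂ (subst (Span B) [x+e]+y≡[x+y]+e (Span-+ B p q))
    where
    [x+e]+y≡[x+y]+e : (x + e) + y ≡ (x + y) + e
    [x+e]+y≡[x+y]+e = trans (assoc x e y) (trans (cong (x +_) (comm e y)) (sym (assoc x y e)))
  Span-+ (e ∷ B) {x} {y} (inj₂ p) (inj₂ q) = inj₁ (subst (Span B) ([x+z]+[y+z]≡x+y x y e) (Span-+ B p q))

  Independent : List V → Set
  Independent []      = ⊤
  Independent (e ∷ B) = ¬ Span B e × Independent B

  record Basis : Set where
    field
      vectors     : List V
      independent : Independent vectors
      spanning    : ∀ x → Span vectors x

  independent-spanning : ∀ n (v : Fin n → V) → Σ[ B ∈ List V ] Independent B × (∀ i → Span B (v i))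
  independent-spanning ℕ.zero    v = [] , tt , λ ()
  independent-spanning (ℕ.suc n) v with independent-spanning n (v ∘ suc)
  ... | B , indep , spans with span? B (v zero)
  ...   | yes v₀∈B = B , indep , λ { zero → v₀∈B ; (suc i) → spans i }
  ...   | no  v₀∉B = v zero ∷ B , (v₀∉B , indep) ,
                     λ { zero → Span-self (v zero) B ; (suc i) → inj₁ (spans i) }

  finiteBasis : ∀ {n} → V ↔ Fin n → Basis
  finiteBasis {n} card with independent-spanning n (Inverse.from card)
  ... | B , indep , spans = record
    { vectors     = B
    ; independent = indep
    ; spanning    = λ x → subst (Span B) (Inverse.strictlyInverseʳ card x) (spans (Inverse.to card x))
    }

  _•_ : Bool → V → V
  true  • x = x
  false • x = 0#

  combine : (V → Bool) → List V → V
  combine h []      = 0#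
  combine h (e ∷ B) = (h e • e) + combine h B

  IsLinear : (V → Bool) → Set
  IsLinear h = ∀ x y → h (x + y) ≡ h x xor h y

  LinearOn : List V → (V → Bool) → Set
  LinearOn B h = ∀ {x y} → Span B x → Span B y → h (x + y) ≡ h x xor h y

  •-xor : ∀ a b x → (a xor b) • x ≡ (a • x) + (b • x)
  •-xor false b     x = sym (identityˡ (b • x))
  •-xor true  false x = sym (identityʳ x)
  •-xor true  true  x = sym (x+x≡0 x)

  combine-xor : ∀ f g B → combine (λ x → f x xor g x) B ≡ combine f B + combine g B
  combine-xor f g []      = sym (identityʳ 0#)
  combine-xor f g (e ∷ B) = begin
    ((f e xor g e) • e) + combine (λ x → f x xor g x) B
      ≡⟨ cong₂ _+_ (•-xor (f e) (g e) e) (combine-xor f g B) ⟩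
    ((f e • e) + (g e • e)) + (combine f B + combine g B)
      ≡⟨ interchange (f e • e) (g e • e) (combine f B) (combine g B) ⟩
    ((f e • e) + combine f B) + ((g e • e) + combine g B) ∎

  combine-cong : ∀ {f g} B → (∀ {x} → Span B x → f x ≡ g x) → combine f B ≡ combine g B
  combine-cong []      f≡g = refl
  combine-cong (e ∷ B) f≡g =
    cong₂ (λ c s → (c • e) + s) (f≡g (Span-self e B)) (combine-cong B (f≡g ∘ inj₁))

  combine-Span : ∀ h B → Span B (combine h B)
  combine-Span h []      = refl
  combine-Span h (e ∷ B) with h e
  ... | false = inj₁ (subst (Span B) (sym (identityˡ (combine h B))) (combine-Span h B))
  ... | true  = inj₂ (subst (Span B) (sym (trans (comm (e + combine h B) e) (x+[x+y]≡y e (combine h B))))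
                                     (combine-Span h B))

  LinearOn-0 : ∀ {h} B → LinearOn B h → h 0# ≡ false
  LinearOn-0 {h} B lin = begin
    h 0#           ≡⟨ cong h (sym (identityʳ 0#)) ⟩
    h (0# + 0#)    ≡⟨ lin (Span-0 B) (Span-0 B) ⟩
    h 0# xor h 0#  ≡⟨ xor-same (h 0#) ⟩
    false          ∎

  extend : ∀ {e B h} → ¬ Span B e → LinearOn B h → (c : Bool) →
    Σ[ h⁺ ∈ (V → Bool) ] LinearOn (e ∷ B) h⁺ × h⁺ e ≡ c × (∀ {x} → Span B x → h⁺ x ≡ h x)
  extend {e} {B} {h} e∉B lin c = h⁺ , lin⁺ , h⁺-e , h⁺-in
    where
    h⁺ : V → Bool
    h⁺ x = if does (span? B x) then h x else c xor h (x + e)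

    h⁺-in : ∀ {x} → Span B x → h⁺ x ≡ h x
    h⁺-in {x} p rewrite dec-true (span? B x) p = refl

    h⁺-out : ∀ {x} → Span B (x + e) → h⁺ x ≡ c xor h (x + e)
    h⁺-out {x} q rewrite dec-false (span? B x) (λ p → e∉B (subst (Span B) (x+[x+y]≡y x e) (Span-+ B p q)))
      = refl

    h⁺-e : h⁺ e ≡ c
    h⁺-e = begin
      h⁺ e             ≡⟨ h⁺-out (subst (Span B) (sym (x+x≡0 e)) (Span-0 B)) ⟩
      c xor h (e + e)  ≡⟨ cong (λ z → c xor h z) (x+x≡0 e) ⟩
      c xor h 0#       ≡⟨ cong (c xor_) (LinearOn-0 B lin) ⟩
      c xor false      ≡⟨ xor-identityʳ c ⟩
      c                ∎

    lin⁺ : LinearOn (e ∷ B) h⁺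
    lin⁺ {x} {y} (inj₁ p) (inj₁ q) = begin
      h⁺ (x + y)     ≡⟨ h⁺-in (Span-+ B p q) ⟩
      h (x + y)      ≡⟨ lin p q ⟩
      h x xor h y    ≡⟨ sym (cong₂ _xor_ (h⁺-in p) (h⁺-in q)) ⟩
      h⁺ x xor h⁺ y  ∎
    lin⁺ {x} {y} (inj₁ p) (inj₂ q) = begin
      h⁺ (x + y)                 ≡⟨ h⁺-out (subst (Span B) (sym (assoc x y e)) (Span-+ B p q)) ⟩
      c xor h ((x + y) + e)      ≡⟨ cong (λ z → c xor h z) (assoc x y e) ⟩
      c xor h (x + (y + e))      ≡⟨ cong (c xor_) (lin p q) ⟩
      c xor (h x xor h (y + e))  ≡⟨ Xor.x∙yz≈y∙xz c (h x) (h (y + e)) ⟩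
      h x xor (c xor h (y + e))  ≡⟨ sym (cong₂ _xor_ (h⁺-in p) (h⁺-out q)) ⟩
      h⁺ x xor h⁺ y              ∎
    lin⁺ {x} {y} (inj₂ p) (inj₁ q) = begin
      h⁺ (x + y)     ≡⟨ cong h⁺ (comm x y) ⟩
      h⁺ (y + x)     ≡⟨ lin⁺ (inj₁ q) (inj₂ p) ⟩
      h⁺ y xor h⁺ x  ≡⟨ xor-comm (h⁺ y) (h⁺ x) ⟩
      h⁺ x xor h⁺ y  ∎
    lin⁺ {x} {y} (inj₂ p) (inj₂ q) = begin
      h⁺ (x + y)                               ≡⟨ h⁺-in (subst (Span B) ([x+z]+[y+z]≡x+y x y e) (Span-+ B p q)) ⟩
      h (x + y)                                ≡⟨ cong h (sym ([x+z]+[y+z]≡x+y x y e)) ⟩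
      h ((x + e) + (y + e))                    ≡⟨ lin p q ⟩
      h (x + e) xor h (y + e)                  ≡⟨ sym (xor-cancel-common c (h (x + e)) (h (y + e))) ⟩
      (c xor h (x + e)) xor (c xor h (y + e))  ≡⟨ sym (cong₂ _xor_ (h⁺-out p) (h⁺-out q)) ⟩
      h⁺ x xor h⁺ y                            ∎

  Span⇒combine : ∀ B → Independent B → ∀ {k} → Span B k →
    Σ[ h ∈ (V → Bool) ] LinearOn B h × combine h B ≡ k
  Span⇒combine []      _ refl = (λ _ → false) , (λ _ _ → refl) , refl
  Span⇒combine (e ∷ B) (e∉B , indep) (inj₁ k∈B) with Span⇒combine B indep k∈B
  ... | h , lin , refl with extend e∉B lin false
  ...   | h⁺ , lin⁺ , h⁺e≡false , h⁺≗h = h⁺ , lin⁺ , (begin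
          (h⁺ e • e) + combine h⁺ B  ≡⟨ cong₂ (λ c s → (c • e) + s) h⁺e≡false (combine-cong B h⁺≗h) ⟩
          0# + combine h B           ≡⟨ identityˡ (combine h B) ⟩
          combine h B                ∎)
  Span⇒combine (e ∷ B) (e∉B , indep) {k} (inj₂ k+e∈B) with Span⇒combine B indep k+e∈B
  ... | h , lin , hB≡k+e with extend e∉B lin true
  ...   | h⁺ , lin⁺ , h⁺e≡true , h⁺≗h = h⁺ , lin⁺ , (begin
          (h⁺ e • e) + combine h⁺ B
            ≡⟨ cong₂ (λ c s → (c • e) + s) h⁺e≡true (trans (combine-cong B h⁺≗h) hB≡k+e) ⟩
          e + (k + e)                ≡⟨ cong (e +_) (comm k e) ⟩
          e + (e + k)                ≡⟨ x+[x+y]≡y e k ⟩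
          k                          ∎)

  combine≡0⇒vanishes : ∀ {h} → IsLinear h → ∀ B → Independent B → combine h B ≡ 0# →
    ∀ {x} → Span B x → h x ≡ false
  combine≡0⇒vanishes {h} lin []      _ _ refl = LinearOn-0 {h} [] (λ {x} {y} _ _ → lin x y)
  combine≡0⇒vanishes {h} lin (e ∷ B) (e∉B , indep) hB≡0 x∈eB with h e in he
  ... | true  = contradiction (subst (Span B) (sym (x+y≡0⇒x≡y hB≡0)) (combine-Span h B)) e∉B
  ... | false = vanishes x∈eB
    where
    vanishesOnB : ∀ {x} → Span B x → h x ≡ false
    vanishesOnB = combine≡0⇒vanishes lin B indep (trans (sym (identityˡ (combine h B))) hB≡0)

    vanishes : ∀ {x} → Span (e ∷ B) x → h x ≡ false
    vanishes     (inj₁ x∈B)   = vanishesOnB x∈B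
    vanishes {x} (inj₂ x+e∈B) = begin
      h x                ≡⟨ cong h (sym ([x+y]+y≡x x e)) ⟩
      h ((x + e) + e)    ≡⟨ lin (x + e) e ⟩
      h (x + e) xor h e  ≡⟨ cong₂ _xor_ (vanishesOnB x+e∈B) he ⟩
      false              ∎

  module _ (β : Basis) where
    open Basis β

    combine-injective : ∀ {h} → IsLinear h → combine h vectors ≡ 0# → ∀ x → h x ≡ false
    combine-injective lin hB≡0 x = combine≡0⇒vanishes lin vectors independent hB≡0 (spanning x)

    combine-surjective : ∀ k → Σ[ h ∈ (V → Bool) ] IsLinear h × combine h vectors ≡ k
    combine-surjective k with Span⇒combine vectors independent (spanning k)
    ... | h , lin , hB≡k = h , (λ x y → lin (spanning x) (spanning y)) , hB≡k

module _ {A : Set} (_≟_ : DecidableEquality A) where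

  ∃-outside-pair : ∀ {n} → A ↔ Fin n → 2 ℕ.< n → ∀ u v → ∃ λ w → w ≢ u × w ≢ v
  ∃-outside-pair {n} card 2<n u v
    with ¬∀⟶∃¬ n (λ i → elem i ≡ u ⊎ elem i ≡ v) (λ i → (elem i ≟ u) ⊎-dec (elem i ≟ v)) not-all
    where
    elem : Fin n → A
    elem = Inverse.from card

    side : ∀ {w} → w ≡ u ⊎ w ≡ v → Fin 2
    side (inj₁ _) = zero
    side (inj₂ _) = suc zero

    same-side : ∀ {w w′} (p : w ≡ u ⊎ w ≡ v) (q : w′ ≡ u ⊎ w′ ≡ v) → side p ≡ side q → w ≡ w′
    same-side (inj₁ w≡u) (inj₁ w′≡u) _ = trans w≡u (sym w′≡u)
    same-side (inj₂ w≡v) (inj₂ w′≡v) _ = trans w≡v (sym w′≡v)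

    not-all : ¬ (∀ i → elem i ≡ u ⊎ elem i ≡ v)
    not-all inPair with pigeonhole 2<n (λ i → side (inPair i))
    ... | i , j , i<j , same = <⇒≢ i<j (begin
      i                         ≡⟨ sym (Inverse.strictlyInverseˡ card i) ⟩
      Inverse.to card (elem i)  ≡⟨ cong (Inverse.to card) (same-side (inPair i) (inPair j) same) ⟩
      Inverse.to card (elem j)  ≡⟨ Inverse.strictlyInverseˡ card j ⟩
      j                         ∎)
      where open ≡-Reasoning
  ... | i , outside = Inverse.from card i , outside ∘ inj₁ , outside ∘ inj₂

module _ {ℓ : ℕ} (F : FiniteField ℓ) where

  open FiniteField F

  commutativeRing : CommutativeRing _ _
  commutativeRing = record { isCommutativeRing = isCommutativeRing }

  open CommutativeRing commutativeRing
    using ( +-isAbelianGroup; +-isCommutativeMonoid; +-assoc; -‿inverseˡ; +-identityˡ; +-identityʳ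
          ; *-assoc; *-comm; *-identityˡ; *-identityʳ; zeroˡ; zeroʳ; distribˡ; distribʳ; ring; semiring)
  open import Algebra.Properties.Ring ring using (-0#≈0#)
  open import Algebra.Properties.Semiring.Mult semiring using (×1-homo-*) renaming (_×_ to _×ₙ_)
  open FiniteAbelianGroup +-isAbelianGroup using (×ₙ-card≡ε)
  open ≡-Reasoning

  ⁻¹*-inverse : ∀ {x} → x ≢ 0# → x ⁻¹ * x ≡ 1#
  ⁻¹*-inverse {x} x≢0 = trans (*-comm (x ⁻¹) x) (*-inverse x x≢0)

  x*y≡0⇒y≡0 : ∀ {x y} → x ≢ 0# → x * y ≡ 0# → y ≡ 0#
  x*y≡0⇒y≡0 {x} {y} x≢0 xy≡0 = begin
    y                ≡⟨ sym (*-identityˡ y) ⟩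
    1# * y           ≡⟨ cong (_* y) (sym (⁻¹*-inverse x≢0)) ⟩
    (x ⁻¹ * x) * y   ≡⟨ *-assoc (x ⁻¹) x y ⟩
    x ⁻¹ * (x * y)   ≡⟨ cong (x ⁻¹ *_) xy≡0 ⟩
    x ⁻¹ * 0#        ≡⟨ zeroʳ (x ⁻¹) ⟩
    0#               ∎

  p^k×1≡0⇒p×1≡0 : ∀ p k → (p ℕ.^ k) ×ₙ 1# ≡ 0# → p ×ₙ 1# ≡ 0#
  p^k×1≡0⇒p×1≡0 p ℕ.zero    1≡0 = contradiction (sym (trans (sym (+-identityʳ 1#)) 1≡0)) 0≢1
  p^k×1≡0⇒p×1≡0 p (ℕ.suc k) pp^k≡0 with (p ×ₙ 1#) ≟ 0#
  ... | yes p≡0 = p≡0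
  ... | no  p≢0 =
    p^k×1≡0⇒p×1≡0 p k (x*y≡0⇒y≡0 p≢0 (trans (sym (×1-homo-* p (p ℕ.^ k))) pp^k≡0))

  1+1≡0 : 1# + 1# ≡ 0#
  1+1≡0 = trans (cong (1# +_) (sym (+-identityʳ 1#))) (p^k×1≡0⇒p×1≡0 2 ℓ (×ₙ-card≡ε card 1#))

  x+x≡0 : ∀ x → x + x ≡ 0#
  x+x≡0 x = begin
    x + x              ≡⟨ cong₂ _+_ (sym (*-identityˡ x)) (sym (*-identityˡ x)) ⟩
    1# * x + 1# * x    ≡⟨ sym (distribʳ x 1# 1#) ⟩
    (1# + 1#) * x      ≡⟨ cong (_* x) 1+1≡0 ⟩
    0# * x             ≡⟨ zeroˡ x ⟩
    0#                 ∎

  open Characteristic2 +-isCommutativeMonoid x+x≡0 using (x+[x+y]≡y; x+y≡0⇒x≡y)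
  open F₂-VectorSpace +-isCommutativeMonoid x+x≡0 _≟_
    using (IsLinear; Basis; finiteBasis; combine; combine-xor; combine-cong; combine-injective; combine-surjective)

  [x+1]*[x+1]≡x*x+1 : ∀ x → (x + 1#) * (x + 1#) ≡ x * x + 1#
  [x+1]*[x+1]≡x*x+1 x = begin
    (x + 1#) * (x + 1#)            ≡⟨ distribʳ (x + 1#) x 1# ⟩
    x * (x + 1#) + 1# * (x + 1#)   ≡⟨ cong₂ _+_ (distribˡ x x 1#) (*-identityˡ (x + 1#)) ⟩
    (x * x + x * 1#) + (x + 1#)    ≡⟨ cong (λ y → (x * x + y) + (x + 1#)) (*-identityʳ x) ⟩
    (x * x + x) + (x + 1#)         ≡⟨ +-assoc (x * x) x (x + 1#) ⟩
    x * x + (x + (x + 1#))         ≡⟨ cong (x * x +_) (x+[x+y]≡y x 1#) ⟩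
    x * x + 1#                     ∎

  x*x≡1⇒x≡1 : ∀ {x} → x * x ≡ 1# → x ≡ 1#
  x*x≡1⇒x≡1 {x} x*x≡1 with (x + 1#) ≟ 0#
  ... | yes x+1≡0 = x+y≡0⇒x≡y x+1≡0
  ... | no  x+1≢0 = contradiction (x*y≡0⇒y≡0 x+1≢0 (begin
    (x + 1#) * (x + 1#)  ≡⟨ [x+1]*[x+1]≡x*x+1 x ⟩
    x * x + 1#           ≡⟨ cong (_+ 1#) x*x≡1 ⟩
    1# + 1#              ≡⟨ 1+1≡0 ⟩
    0#                   ∎)) x+1≢0

  scaling-invariant⇒zero : ∀ {h a} → IsLinear h → a ≢ 1# → (∀ c → h (a * c) ≡ h c) →
                           ∀ x → h x ≡ false
  scaling-invariant⇒zero {h} {a} lin a≢1 invariant x = begin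
    h x                  ≡⟨ cong h (sym ac+c≡x) ⟩
    h (a * c + c)        ≡⟨ lin (a * c) c ⟩
    h (a * c) xor h c    ≡⟨ cong (_xor h c) (invariant c) ⟩
    h c xor h c          ≡⟨ xor-same (h c) ⟩
    false                ∎
    where
    c : Carrier
    c = (a + 1#) ⁻¹ * x

    ac+c≡x : a * c + c ≡ x
    ac+c≡x = begin
      a * c + c                   ≡⟨ cong (a * c +_) (sym (*-identityˡ c)) ⟩
      a * c + 1# * c              ≡⟨ sym (distribʳ c a 1#) ⟩
      (a + 1#) * c                ≡⟨ sym (*-assoc (a + 1#) ((a + 1#) ⁻¹) x) ⟩
      ((a + 1#) * (a + 1#) ⁻¹) * x ≡⟨ cong (_* x) (*-inverse (a + 1#) (a≢1 ∘ x+y≡0⇒x≡y)) ⟩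
      1# * x                      ≡⟨ *-identityˡ x ⟩
      x                           ∎

  pattern ∞ = nothing

  infixl 7 _⋅_
  _⋅_ : Mat F → Mat F → Mat F
  _⋅_ = _·_ F

  infixl 6 _⊕′_
  _⊕′_ : Cochain F → Cochain F → Cochain F
  _⊕′_ = _⊕_ F

  shear : Carrier → Mat F
  shear b = mat 1# b 0# 1#

  diagonal : Carrier → Mat F
  diagonal d = mat (d ⁻¹) 0# 0# d

  shear-InT : ∀ b → InT F (shear b)
  shear-InT b = refl , refl , refl

  diagonal-InU : ∀ {d} → d ≢ 0# → InU F (diagonal d)
  diagonal-InU d≢0 = refl , ⁻¹*-inverse d≢0

  mat-cong : ∀ {a b c d a′ b′ c′ d′} → a ≡ a′ → b ≡ b′ → c ≡ c′ → d ≡ d′ →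
             mat {F = F} a b c d ≡ mat a′ b′ c′ d′
  mat-cong refl refl refl refl = refl

  ⋅-upper : ∀ a b d a′ b′ d′ →
            mat a b 0# d ⋅ mat a′ b′ 0# d′ ≡ mat (a * a′) (a * b′ + b * d′) 0# (d * d′)
  ⋅-upper a b d a′ b′ d′ = mat-cong
    (trans (cong (a * a′ +_) (zeroʳ b)) (+-identityʳ (a * a′)))
    refl
    (trans (cong₂ _+_ (zeroˡ a′) (zeroʳ d)) (+-identityʳ 0#))
    (trans (cong (_+ d * d′) (zeroˡ b′)) (+-identityˡ (d * d′)))

  shear-⋅ : ∀ b c → shear b ⋅ shear c ≡ shear (c + b)
  shear-⋅ b c = trans (⋅-upper 1# b 1# 1# c 1#)
    (mat-cong (*-identityˡ 1#) (cong₂ _+_ (*-identityˡ c) (*-identityʳ b)) refl (*-identityˡ 1#))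

  inv-diagonal : ∀ d → inv F (diagonal d) ≡ mat d 0# 0# (d ⁻¹)
  inv-diagonal d = mat-cong refl -0#≈0# -0#≈0# refl

  conjugate-shear : ∀ {d} → d ≢ 0# → ∀ c → (inv F (diagonal d) ⋅ shear c) ⋅ diagonal d ≡ shear (d * d * c)
  conjugate-shear {d} d≢0 c = begin
    (inv F (diagonal d) ⋅ shear c) ⋅ diagonal d
      ≡⟨ cong (λ g → (g ⋅ shear c) ⋅ diagonal d) (inv-diagonal d) ⟩
    (mat d 0# 0# (d ⁻¹) ⋅ shear c) ⋅ diagonal d
      ≡⟨ cong (_⋅ diagonal d) (⋅-upper d 0# (d ⁻¹) 1# c 1#) ⟩
    mat (d * 1#) (d * c + 0# * 1#) 0# (d ⁻¹ * 1#) ⋅ diagonal d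
      ≡⟨ ⋅-upper (d * 1#) (d * c + 0# * 1#) (d ⁻¹ * 1#) (d ⁻¹) 0# d ⟩
    mat (d * 1# * d ⁻¹) (d * 1# * 0# + (d * c + 0# * 1#) * d) 0# (d ⁻¹ * 1# * d)
      ≡⟨ mat-cong (trans (cong (_* d ⁻¹) (*-identityʳ d)) (*-inverse d d≢0)) corner refl
                  (trans (cong (_* d) (*-identityʳ (d ⁻¹))) (⁻¹*-inverse d≢0)) ⟩
    shear (d * d * c) ∎
    where
    corner : d * 1# * 0# + (d * c + 0# * 1#) * d ≡ d * d * c
    corner = begin
      d * 1# * 0# + (d * c + 0# * 1#) * d  ≡⟨ cong₂ (λ y z → y + (d * c + z) * d) (zeroʳ (d * 1#)) (zeroˡ 1#) ⟩
      0# + (d * c + 0#) * d                ≡⟨ +-identityˡ _ ⟩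
      (d * c + 0#) * d                     ≡⟨ cong (_* d) (+-identityʳ (d * c)) ⟩
      d * c * d                            ≡⟨ *-comm (d * c) d ⟩
      d * (d * c)                          ≡⟨ sym (*-assoc d d c) ⟩
      d * d * c                            ∎

  line-∞ : ∀ {p q} → q ≡ 0# → line F (p , q) ≡ ∞
  line-∞ {q = q} q≡0 with q ≟ 0#
  ... | yes _   = refl
  ... | no  q≢0 = contradiction q≡0 q≢0

  line-1 : ∀ p → line F (p , 1#) ≡ just p
  line-1 p with 1# ≟ 0#
  ... | yes 1≡0 = contradiction (sym 1≡0) 0≢1
  ... | no  1≢0 = cong just (trans (cong (p *_) 1⁻¹≡1) (*-identityʳ p))
    where
    1⁻¹≡1 : 1# ⁻¹ ≡ 1#
    1⁻¹≡1 = trans (sym (*-identityˡ (1# ⁻¹))) (*-inverse 1# 1≢0)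

  lower-left-0⇒fixes-∞ : ∀ {a b c d} → c ≡ 0# → actX F (mat a b c d) ∞ ≡ ∞
  lower-left-0⇒fixes-∞ {c = c} {d} c≡0 = line-∞ (begin
    c * 1# + d * 0#  ≡⟨ cong₂ _+_ (trans (*-identityʳ c) c≡0) (zeroʳ d) ⟩
    0# + 0#          ≡⟨ +-identityʳ 0# ⟩
    0#               ∎)

  inv-shear-∞ : ∀ b → actX F (inv F (shear b)) ∞ ≡ ∞
  inv-shear-∞ b = lower-left-0⇒fixes-∞ -0#≈0#

  inv-diagonal-∞ : ∀ d → actX F (inv F (diagonal d)) ∞ ≡ ∞
  inv-diagonal-∞ d = lower-left-0⇒fixes-∞ -0#≈0#

  inv-shear-just : ∀ b x → actX F (inv F (shear b)) (just x) ≡ just (x + - b)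
  inv-shear-just b x = begin
    line F (1# * x + - b * 1# , - 0# * x + 1# * 1#)  ≡⟨ cong (λ q → line F (1# * x + - b * 1# , q)) second ⟩
    line F (1# * x + - b * 1# , 1#)                  ≡⟨ line-1 _ ⟩
    just (1# * x + - b * 1#)                         ≡⟨ cong just (cong₂ _+_ (*-identityˡ x) (*-identityʳ (- b))) ⟩
    just (x + - b)                                   ∎
    where
    second : - 0# * x + 1# * 1# ≡ 1#
    second = begin
      - 0# * x + 1# * 1#  ≡⟨ cong₂ _+_ (trans (cong (_* x) -0#≈0#) (zeroˡ x)) (*-identityˡ 1#) ⟩
      0# + 1#             ≡⟨ +-identityˡ 1# ⟩
      1#                  ∎

  at∞ : Cochain F → Carrier → Bool
  at∞ ω b = ω (shear b) ∞

  at∞-linear : ∀ ω → IsCocycle F ω → IsLinear (at∞ ω)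
  at∞-linear ω cocycle x y = begin
    ω (shear (x + y)) ∞
      ≡⟨ cong (λ g → ω g ∞) (sym (shear-⋅ y x)) ⟩
    ω (shear y ⋅ shear x) ∞
      ≡⟨ cocycle (shear y) (shear x) (shear-InT y) (shear-InT x) ∞ ⟩
    ω (shear x) (actX F (inv F (shear y)) ∞) xor at∞ ω y
      ≡⟨ cong (λ z → ω (shear x) z xor at∞ ω y) (inv-shear-∞ y) ⟩
    at∞ ω x xor at∞ ω y ∎

  coboundary⇒at∞≡0 : ∀ ω → IsCoboundary F ω → ∀ b → at∞ ω b ≡ false
  coboundary⇒at∞≡0 ω (v , coboundary) b = begin
    at∞ ω b                                   ≡⟨ coboundary (shear b) (shear-InT b) ∞ ⟩
    v (actX F (inv F (shear b)) ∞) xor v ∞    ≡⟨ cong (λ z → v z xor v ∞) (inv-shear-∞ b) ⟩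
    v ∞ xor v ∞                               ≡⟨ xor-same (v ∞) ⟩
    false                                     ∎

  -- On X ∖ {∞} ≅ T the module is regular, and v(x) := ω(shear x)(x) is the usual
  -- trivialisation of a cocycle with values in F₂[T].
  at∞≡0⇒coboundary : ∀ ω → IsCocycle F ω → (∀ b → at∞ ω b ≡ false) → IsCoboundary F ω
  at∞≡0⇒coboundary ω cocycle at∞≡0 = v , coboundary
    where
    v : M F
    v ∞        = false
    v (just x) = ω (shear x) (just x)

    coboundary : ∀ g → InT F g → ∀ y → ω g y ≡ actM F g v y xor v y
    coboundary (mat _ b _ _) (refl , refl , refl) ∞ =
      trans (at∞≡0 b) (sym (cong (λ z → v z xor false) (inv-shear-∞ b)))
    coboundary (mat _ b _ _) (refl , refl , refl) (just x) = begin
      ω (shear b) (just x)                    ≡⟨ sym (Bool₂.x+[x+y]≡y (v (just z)) _) ⟩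
      v (just z) xor (v (just z) xor ω (shear b) (just x))
                                              ≡⟨ cong (v (just z) xor_) (sym translate) ⟩
      v (just z) xor v (just x)               ≡⟨ cong (λ y → v y xor v (just x)) (sym (inv-shear-just b x)) ⟩
      actM F (shear b) v (just x) xor v (just x) ∎
      where
      z : Carrier
      z = x + - b

      translate : v (just x) ≡ v (just z) xor ω (shear b) (just x)
      translate = begin
        ω (shear x) (just x)
          ≡⟨ cong (λ g → ω g (just x)) (trans (cong shear (sym z+b≡x)) (sym (shear-⋅ b z))) ⟩
        ω (shear b ⋅ shear z) (just x)
          ≡⟨ cocycle (shear b) (shear z) (shear-InT b) (shear-InT z) (just x) ⟩
        ω (shear z) (actX F (inv F (shear b)) (just x)) xor ω (shear b) (just x)
          ≡⟨ cong (λ y → ω (shear z) y xor ω (shear b) (just x)) (inv-shear-just b x) ⟩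
        v (just z) xor ω (shear b) (just x) ∎
        where
        z+b≡x : z + b ≡ x
        z+b≡x = trans (+-assoc x (- b) b) (trans (cong (x +_) (-‿inverseˡ b)) (+-identityʳ x))

  cocycleOf : (Carrier → Bool) → Cochain F
  cocycleOf h g ∞        = h (Mat.b g)
  cocycleOf h g (just _) = false

  cocycleOf-isCocycle : ∀ h → IsLinear h → IsCocycle F (cocycleOf h)
  cocycleOf-isCocycle h lin (mat _ b _ _) (mat _ c _ _) (refl , refl , refl) (refl , refl , refl) ∞ = begin
    h (Mat.b (shear b ⋅ shear c))  ≡⟨ cong (h ∘ Mat.b) (shear-⋅ b c) ⟩
    h (c + b)                      ≡⟨ lin c b ⟩
    h c xor h b                    ≡⟨ cong (λ z → cocycleOf h (shear c) z xor h b) (sym (inv-shear-∞ b)) ⟩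
    actM F (shear b) (cocycleOf h (shear c)) ∞ xor h b ∎
  cocycleOf-isCocycle h lin (mat _ b _ _) (mat _ c _ _) (refl , refl , refl) (refl , refl , refl) (just x) =
    sym (cong (λ z → cocycleOf h (shear c) z xor false) (inv-shear-just b x))

  ⊕-isCocycle : ∀ ω ω′ → IsCocycle F ω → IsCocycle F ω′ → IsCocycle F (ω ⊕′ ω′)
  ⊕-isCocycle ω ω′ cocycle cocycle′ g h g∈T h∈T y =
    trans (cong₂ _xor_ (cocycle g h g∈T h∈T y) (cocycle′ g h g∈T h∈T y))
          (Xor.interchange (ω h (actX F (inv F g) y)) (ω g y) (ω′ h (actX F (inv F g) y)) (ω′ g y))

  basis : Basis
  basis = finiteBasis card

  class : Cochain F → Carrier
  class ω = combine (at∞ ω) (Basis.vectors basis)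

  cohomologous⇒same-class : ∀ ω ω′ → Cohomologous F ω ω′ → class ω ≡ class ω′
  cohomologous⇒same-class ω ω′ coboundary =
    combine-cong (Basis.vectors basis)
                 (λ {b} _ → Bool₂.x+y≡0⇒x≡y (coboundary⇒at∞≡0 (ω ⊕′ ω′) coboundary b))

  same-class⇒cohomologous : ∀ ω ω′ → IsCocycle F ω → IsCocycle F ω′ →
                            class ω ≡ class ω′ → Cohomologous F ω ω′
  same-class⇒cohomologous ω ω′ cocycle cocycle′ same =
    at∞≡0⇒coboundary (ω ⊕′ ω′) cocycle⊕
      (combine-injective basis (at∞-linear (ω ⊕′ ω′) cocycle⊕) class≡0)
    where
    cocycle⊕ : IsCocycle F (ω ⊕′ ω′)
    cocycle⊕ = ⊕-isCocycle ω ω′ cocycle cocycle′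

    class≡0 : class (ω ⊕′ ω′) ≡ 0#
    class≡0 = begin
      class (ω ⊕′ ω′)      ≡⟨ combine-xor (at∞ ω) (at∞ ω′) (Basis.vectors basis) ⟩
      class ω + class ω′   ≡⟨ cong (_+ class ω′) same ⟩
      class ω′ + class ω′  ≡⟨ x+x≡0 (class ω′) ⟩
      0#                   ∎

  H¹≅F : H1≅F F
  H¹≅F = class
       , (λ ω ω′ _ _ → combine-xor (at∞ ω) (at∞ ω′) (Basis.vectors basis))
       , (λ ω ω′ cocycle cocycle′ →
            mk⇔ (cohomologous⇒same-class ω ω′) (same-class⇒cohomologous ω ω′ cocycle cocycle′))
       , λ k → let (h , lin , hB≡k) = combine-surjective basis k in
               cocycleOf h , cocycleOf-isCocycle h lin , hB≡k

  at∞-actU-diagonal : ∀ {d} → d ≢ 0# → ∀ ω c → at∞ (actU F (diagonal d) ω) c ≡ at∞ ω (d * d * c)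
  at∞-actU-diagonal {d} d≢0 ω c = cong₂ ω (conjugate-shear d≢0 c) (inv-diagonal-∞ d)

  ∃≢0,1 : 2 ≤ ℓ → ∃ λ d → d ≢ 0# × d ≢ 1#
  ∃≢0,1 2≤ℓ = ∃-outside-pair _≟_ card (ℕ.≤-trans (ℕ.n≤1+n 3) (ℕ.^-monoʳ-≤ 2 2≤ℓ)) 0# 1#

  H¹-invariants-vanish : 2 ≤ ℓ → H1-fixed-zero F
  H¹-invariants-vanish 2≤ℓ ω cocycle fixed with ∃≢0,1 2≤ℓ
  ... | d , d≢0 , d≢1 =
    at∞≡0⇒coboundary ω cocycle (scaling-invariant⇒zero (at∞-linear ω cocycle) (d≢1 ∘ x*x≡1⇒x≡1) invariant)
    where
    invariant : ∀ c → at∞ ω (d * d * c) ≡ at∞ ω c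
    invariant c = trans (sym (at∞-actU-diagonal d≢0 ω c)) (Bool₂.x+y≡0⇒x≡y
      (coboundary⇒at∞≡0 (actU F (diagonal d) ω ⊕′ ω) (fixed (diagonal d) (diagonal-InU d≢0)) c))

lemma5p21 : (ℓ : ℕ) → 2 ≤ ℓ → (F : FiniteField ℓ) → H1≅F F × H1-fixed-zero F
lemma5p21 ℓ 2≤ℓ F = H¹≅F F , H¹-invariants-vanish F 2≤ℓ
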